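{- Let $T$ be an $s$-decreasing tree and let $1\le a<b\le n$ be such that $(a,b)$ is a tree ascent of $T$ with $s(a)>0$. Then no pair of the form $(e,b)$ with $e\in T^a$ and $e<a$ is a tree ascent of $T$.
   Context: $s=(s(1),\dots,s(n))$ is a sequence of nonnegative integers. An $s$-decreasing tree is a planar rooted tree $T$ whose internal vertices are labeled bijectively by $1,\dots,n$ (leaves unlabeled), such that internal vertex $i$ has exactly $s(i)+1$ children indexed $0,\dots,s(i)$ from left to right, and every labeled descendant of $i$ has smaller label. $T^i$ is the full subtree rooted at $i$ and $T^i_j$ the full subtree rooted at the $j$-th child of $i$; $x\in T^i_j$ means $x$ is a labeled vertex of it. For $a<b$, $(a,b)$ is a tree ascent of $T$ if (i) $a\in T^b_i$ for some $0\le i<s(b)$; (ii) whenever $a<e<b$ and $a\in T^e_j$, then $j=s(e)$; (iii) if $s(a)>0$ then $T^a_{s(a)}$ is a leaf (contains no labeled vertex). -}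

module Defs where

open import Data.Nat using (ℕ; zero; suc; _<_; _≤_)
open import Data.List using (List; []; _∷_; _++_; length; map; upTo)
open import Data.List.Membership.Propositional using (_∈_)
open import Data.List.Relation.Binary.Permutation.Propositional using (_↭_)
open import Data.Product using (Σ; _×_; ∃; ∃-syntax)
open import Relation.Binary.PropositionalEquality using (_≡_)
open import Relation.Nullary using (¬_)

-- Planar rooted trees: leaves are unlabeled, internal vertices carry a
-- natural-number label and an ordered list of children.
data Tree : Set where
  leaf : Tree
  node : ℕ → List Tree → Tree

mutual
  labels : Tree → List ℕ
  labels leaf        = []
  labels (node i cs) = i ∷ labelsF cs

  labelsF : List Tree → List ℕ
  labelsF []       = []
  labelsF (c ∷ cs) = labels c ++ labelsF cs

-- Child cs j c : c is the j-th (0-indexed, left to right) element of cs.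
data Child : List Tree → ℕ → Tree → Set where
  here  : ∀ {c cs} → Child (c ∷ cs) zero c
  there : ∀ {d cs j c} → Child cs j c → Child (d ∷ cs) (suc j) c

data _⊑_ : Tree → Tree → Set where
  refl⊑ : ∀ {t} → t ⊑ t
  down  : ∀ {t i cs j c} → Child cs j c → t ⊑ c → t ⊑ node i cs

record SDecreasing (s : ℕ → ℕ) (n : ℕ) (T : Tree) : Set where
  field
    bijective  : labels T ↭ map suc (upTo n)
    arity      : ∀ {i cs} → node i cs ⊑ T → length cs ≡ suc (s i)
    decreasing : ∀ {i cs} → node i cs ⊑ T → ∀ {x} → x ∈ labelsF cs → x < i

-- SubtreeAt T b t : t = T^b, the full subtree of T rooted at vertex b.
SubtreeAt : Tree → ℕ → Tree → Set
SubtreeAt T b t = Σ (List Tree) λ cs → (t ≡ node b cs) × (node b cs ⊑ T)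

-- x ∈ T^b : x is a labeled vertex of the subtree rooted at b.
InSub : Tree → ℕ → ℕ → Set
InSub T b x = ∃[ t ] (SubtreeAt T b t × x ∈ labels t)

-- ChildSub T b j t : t = T^b_j, the full subtree rooted at the j-th child of b.
ChildSub : Tree → ℕ → ℕ → Tree → Set
ChildSub T b j t = ∃[ cs ] (node b cs ⊑ T × Child cs j t)

InChild : Tree → ℕ → ℕ → ℕ → Set
InChild T b j x = ∃[ t ] (ChildSub T b j t × x ∈ labels t)

record TreeAscent (s : ℕ → ℕ) (T : Tree) (a b : ℕ) : Set where
  field
    a<b   : a < b
    cond1 : ∃[ i ] (i < s b × InChild T b i a)
    cond2 : ∀ {e j} → a < e → e < b → InChild T e j a → j ≡ s e
    cond3 : 0 < s a → ∀ {t} → ChildSub T a (s a) t → labels t ≡ []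

module Submission where

open import Defs
open import Data.Nat using (ℕ; _<_; _≤_)
open import Data.Nat.Properties using (<⇒≢)
open import Data.List using (List; _∷_)
open import Data.List.Membership.Propositional using (_∈_)
open import Data.List.Membership.Propositional.Properties using (∈-++⁻; ∉[])
open import Data.List.Relation.Unary.Any using (here; there)
open import Data.Product using (_×_; _,_; ∃-syntax)
open import Data.Sum using (inj₁; inj₂)
open import Relation.Nullary using (¬_; contradiction)
open import Relation.Binary.PropositionalEquality using (_≢_; refl; subst)

-- If (e,b) is an ascent then a (with e < a < b) must see e in its last child,
-- but (a,b) being an ascent with s(a) > 0 makes that last child a leaf.

∈-labelsF⁻ : ∀ {x} (cs : List Tree) → x ∈ labelsF cs →
             ∃[ j ] ∃[ t ] (Child cs j t × x ∈ labels t)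
∈-labelsF⁻ (c ∷ cs) x∈ with ∈-++⁻ (labels c) x∈
... | inj₁ x∈c  = _ , c , Child.here , x∈c
... | inj₂ x∈cs with ∈-labelsF⁻ cs x∈cs
...   | j , t , ch , x∈t = _ , t , Child.there ch , x∈t

InSub⇒InChild : ∀ {T a e} → InSub T a e → e ≢ a → ∃[ j ] InChild T a j e
InSub⇒InChild (_ , (_  , refl , _) , here e≡a) e≢a = contradiction e≡a e≢a
InSub⇒InChild (_ , (cs , refl , a⊑T) , there e∈cs) _ with ∈-labelsF⁻ cs e∈cs
... | j , t , ch , e∈t = j , t , (cs , a⊑T , ch) , e∈t

lastChild-unlabelled : ∀ {s T a b} → TreeAscent s T a b → 0 < s a →
                       ∀ {x} → ¬ InChild T a (s a) x
lastChild-unlabelled asc 0<sa (t , a→t , x∈t) =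
  ∉[] (subst (_ ∈_) (TreeAscent.cond3 asc 0<sa a→t) x∈t)

proposition3p3 : (s : ℕ → ℕ) (n : ℕ) (T : Tree) → SDecreasing s n T →
    (a b : ℕ) → 1 ≤ a → a < b → b ≤ n →
    TreeAscent s T a b → 0 < s a →
    ∀ e → InSub T a e → e < a → ¬ TreeAscent s T e b
proposition3p3 s n T _ a b _ a<b _ ascᵃᵇ 0<sa e e∈Tᵃ e<a ascᵉᵇ
  with InSub⇒InChild e∈Tᵃ (<⇒≢ e<a)
... | j , e∈Tᵃⱼ with TreeAscent.cond2 ascᵉᵇ e<a a<b e∈Tᵃⱼ
...   | refl = lastChild-unlabelled ascᵃᵇ 0<sa e∈Tᵃⱼ
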